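{- Let $\mathbf{v}=(v_1,\dots,v_m)$ and $\mathbf{k}=(k_1,\dots,k_m)$ be $m$-tuples of positive integers with $\mathbf{v}\ge\mathbf{k}$ and $\sum_i k_i\ge 2$, and let $I=\{i: v_i\ne k_i\}$. Then, provided $\mathbf{k}^I\ne(1)$, we have $C(\mathbf{v},\mathbf{k},2)=C(\mathbf{v}^I,\mathbf{k}^I,2)$.
   Context: $\mathbf{v}\ge\mathbf{k}$ means componentwise. For a tuple $\mathbf{x}$ and a set $I$ of positions, the restriction $\mathbf{x}^I$ is the tuple of entries of $\mathbf{x}$ in the positions in $I$ (in increasing order of position). Generalized covering designs: for $p$-tuples of positive integers $\mathbf{v}$, $\mathbf{k}$ with $k_i\le v_i$ and an integer $t$ with $1\le t\le \sum_i k_i$, let $X_1,\dots,X_p$ be pairwise disjoint sets with $|X_i|=v_i$. A block is a $p$-tuple $(B_1,\dots,B_p)$ with $B_i\subseteq X_i$, $|B_i|=k_i$. A $p$-tuple of sets $(T_1,\dots,T_p)$ is $(\mathbf{v},\mathbf{k},t)$-admissible if $T_i\subseteq X_i$, $|T_i|\le k_i$ and $\sum_i|T_i|=t$; it is contained in a block if $T_i\subseteq B_i$ for all $i$. A ${\rm GC}(\mathbf{v},\mathbf{k},t)$ is a family of blocks (repetitions allowed) such that every admissible tuple is contained in at least one block, and $C(\mathbf{v},\mathbf{k},t)$ is the minimum number of blocks of a ${\rm GC}(\mathbf{v},\mathbf{k},t)$ (taken to be $0$ if no design exists or there are no admissible tuples). -}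

module Defs where

open import Data.Nat using (ℕ; zero; suc; _+_; _≤_; _≟_)
open import Data.Fin using (Fin)
open import Data.Fin.Subset using (Subset; _⊆_; ∣_∣)
open import Data.List using (List; []; _∷_; length; filter; allFin; lookup)
open import Data.List.Relation.Unary.Any using (Any)
open import Data.Vec.Functional using (foldr)
open import Data.Product using (Σ; ∃; _×_; _,_; proj₁)
open import Data.Sum using (_⊎_)
open import Relation.Nullary using (¬_; ¬?)
open import Relation.Binary.PropositionalEquality using (_≡_)

-- Parameters of a p-tuple: functions Fin p → ℕ.  The ground set X_i is Fin (v i).

Σ-tuple : ∀ {p} → (Fin p → ℕ) → ℕ
Σ-tuple x = foldr _+_ 0 x

Block : (p : ℕ) (v k : Fin p → ℕ) → Set
Block p v k = (i : Fin p) → Σ (Subset (v i)) (λ B → ∣ B ∣ ≡ k i)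

Tuple : (p : ℕ) (v : Fin p → ℕ) → Set
Tuple p v = (i : Fin p) → Subset (v i)

Admissible : (p : ℕ) (v k : Fin p → ℕ) (t : ℕ) → Tuple p v → Set
Admissible p v k t T = ((i : Fin p) → ∣ T i ∣ ≤ k i) × Σ-tuple (λ i → ∣ T i ∣) ≡ t

ContainedIn : (p : ℕ) (v k : Fin p → ℕ) → Tuple p v → Block p v k → Set
ContainedIn p v k T B = (i : Fin p) → T i ⊆ proj₁ (B i)

-- A GC(v,k,t): a list (family with repetitions) of blocks covering every admissible tuple.
IsGC : (p : ℕ) (v k : Fin p → ℕ) (t : ℕ) → List (Block p v k) → Set
IsGC p v k t D = (T : Tuple p v) → Admissible p v k t T → Any (ContainedIn p v k T) D

-- "n = C(v,k,t)": n is the minimum size of a GC(v,k,t), or n = 0 if no GC exists.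
-- (If there are no admissible tuples, the empty family is a GC, so the minimum is 0.)
IsC : (p : ℕ) (v k : Fin p → ℕ) (t : ℕ) → ℕ → Set
IsC p v k t n =
  (Σ (List (Block p v k)) (λ D → IsGC p v k t D × length D ≡ n)
     × ((D : List (Block p v k)) → IsGC p v k t D → n ≤ length D))
  ⊎ ((¬ Σ (List (Block p v k)) (λ D → IsGC p v k t D)) × n ≡ 0)

diffPositions : ∀ {m} → (v k : Fin m → ℕ) → List (Fin m)
diffPositions {m} v k = filter (λ i → ¬? (v i ≟ k i)) (allFin m)

restrict : ∀ {m} → (Fin m → ℕ) → (I : List (Fin m)) → Fin (length I) → ℕ
restrict x I j = x (lookup I j)

-- Restricting blocks to the positions in I, and extending blocks of the
-- restricted problem by the whole of X_i wherever v_i = k_i (X_i is then its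
-- own unique k_i-subset), are length-preserving maps between GC(v,k,t)'s and
-- GC(v^I,k^I,t)'s in both directions, so the two minima coincide.  Restriction
-- preserves covering because an admissible tuple of the restricted problem,
-- padded with empty sets, is admissible for the original one.  Extension
-- preserves covering because an admissible tuple of the original problem
-- restricts to a tuple of total size at most t, and a t-covering also covers
-- every smaller tuple fitting into the blocks, provided t ≤ Σ k^I.  For t = 2
-- this last condition is exactly I ≠ ∅ and k^I ≠ (1).
module Submission where

open import Defs
open import Data.Nat using (ℕ; _≤_)
open import Data.Fin using (Fin)
open import Data.List using (List; []; _∷_; length)
open import Data.Product using (∃; _×_)
open import Relation.Nullary using (¬_)
open import Relation.Binary.PropositionalEquality using (_≡_; _≢_)
open import Function.Bundles using (_⇔_)

open import Data.Nat using (zero; suc; _+_; _∸_; _<_; _≟_; _<?_; z≤n; s≤s)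
open import Data.Nat.Properties
open import Data.Nat.ListAction using (sum)
open import Algebra.Properties.Monoid.Sum +-0-monoid using (sum-cong-≗)
open import Data.Fin using (zero; suc)
import Data.Fin.Properties as Fin
open import Data.Fin.Subset using (Subset; inside; outside; _∈_; _⊆_; ∣_∣; ⊤; ⊥)
open import Data.Fin.Subset.Properties using (⊆-refl; out⊆; s⊆s; ∣⊤∣≡n; ∣⊥∣≡0; ⊆⊤)
open import Data.Vec using (_∷_)
open import Data.List using (map; filter; lookup; allFin; tabulate)
open import Data.List.Properties using (length-map; map-tabulate)
open import Data.List.Relation.Unary.Any as Any using (Any)
open import Data.List.Relation.Unary.Any.Properties using (map⁺; lookup-index)
open import Data.List.Relation.Unary.All as All using ()
open import Data.List.Relation.Unary.AllPairs using (_∷_)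
open import Data.List.Relation.Unary.Unique.Propositional using (Unique)
open import Data.List.Relation.Unary.Unique.Propositional.Properties using (filter⁺; allFin⁺)
open import Data.List.Membership.Propositional.Properties using (∈-lookup; ∈-filter⁺; ∈-filter⁻; ∈-allFin)
open import Data.Product using (Σ; _,_; proj₂)
open import Data.Sum using (_⊎_; inj₁; inj₂)
open import Data.Empty using (⊥-elim)
open import Function using (_∘_; id; mk⇔)
open import Relation.Nullary using (Dec; yes; no; ¬?)
open import Relation.Unary using (Pred; Decidable)
open import Relation.Binary.PropositionalEquality using (refl; sym; trans; cong; cong₂; subst; module ≡-Reasoning)

sum-tabulate : ∀ {p} (f : Fin p → ℕ) → sum (tabulate f) ≡ Σ-tuple f
sum-tabulate {zero} f = refl
sum-tabulate {suc p} f = cong (f zero +_) (sum-tabulate (f ∘ suc))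

Σ-tuple≡sum-allFin : ∀ {p} (f : Fin p → ℕ) → Σ-tuple f ≡ sum (map f (allFin p))
Σ-tuple≡sum-allFin f = trans (sym (sum-tabulate f)) (cong sum (sym (map-tabulate id f)))

Σ-tuple-lookup : ∀ {a} {A : Set a} (xs : List A) (f : A → ℕ) →
                 Σ-tuple (f ∘ lookup xs) ≡ sum (map f xs)
Σ-tuple-lookup []       f = refl
Σ-tuple-lookup (x ∷ xs) f = cong (f x +_) (Σ-tuple-lookup xs f)

module _ {a p} {A : Set a} {P : Pred A p} (P? : Decidable P) (f : A → ℕ) where

  sum-map-filter-≤ : ∀ xs → sum (map f (filter P? xs)) ≤ sum (map f xs)
  sum-map-filter-≤ [] = z≤n
  sum-map-filter-≤ (x ∷ xs) with P? x
  ... | yes _ = +-monoʳ-≤ (f x) (sum-map-filter-≤ xs)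
  ... | no _  = ≤-trans (sum-map-filter-≤ xs) (m≤n+m _ (f x))

  sum-map-filter : (∀ x → ¬ P x → f x ≡ 0) → ∀ xs → sum (map f (filter P? xs)) ≡ sum (map f xs)
  sum-map-filter f≡0 [] = refl
  sum-map-filter f≡0 (x ∷ xs) with P? x
  ... | yes _  = cong (f x +_) (sum-map-filter f≡0 xs)
  ... | no ¬px = trans (sum-map-filter f≡0 xs) (cong (_+ sum (map f xs)) (sym (f≡0 x ¬px)))

Σ-tuple-sucAt : ∀ {p} (f g : Fin p → ℕ) (i : Fin p) → g i ≡ suc (f i) →
                (∀ j → j ≢ i → g j ≡ f j) → Σ-tuple g ≡ suc (Σ-tuple f)
Σ-tuple-sucAt f g zero    gi≡ g≡f =
  cong₂ _+_ gi≡ (sum-cong-≗ (λ j → g≡f (suc j) λ ()))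
Σ-tuple-sucAt f g (suc i) gi≡ g≡f = begin
  g zero + Σ-tuple (g ∘ suc)        ≡⟨ cong₂ _+_ (g≡f zero λ ()) (Σ-tuple-sucAt (f ∘ suc) (g ∘ suc) i gi≡ g≡f∘suc) ⟩
  f zero + suc (Σ-tuple (f ∘ suc))  ≡⟨ +-suc (f zero) _ ⟩
  suc (Σ-tuple f)                   ∎
  where
  open ≡-Reasoning
  g≡f∘suc : ∀ j → j ≢ i → g (suc j) ≡ f (suc j)
  g≡f∘suc j j≢i = g≡f (suc j) (j≢i ∘ Fin.suc-injective)

Σ<Σ⇒∃< : ∀ {p} (f g : Fin p → ℕ) → Σ-tuple f < Σ-tuple g → ∃ λ i → f i < g i
Σ<Σ⇒∃< {zero}  f g ()
Σ<Σ⇒∃< {suc p} f g Σf<Σg with f zero <? g zero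
... | yes f₀<g₀ = zero , f₀<g₀
... | no  f₀≮g₀ =
  let i , fi<gi = Σ<Σ⇒∃< (f ∘ suc) (g ∘ suc)
                    (+-cancelˡ-< (g zero) _ _ (≤-<-trans (+-monoˡ-≤ _ (≮⇒≥ f₀≮g₀)) Σf<Σg))
  in suc i , fi<gi

grow-subset : ∀ {n} (S : Subset n) → ∣ S ∣ < n → ∃ λ S′ → S ⊆ S′ × ∣ S′ ∣ ≡ suc ∣ S ∣
grow-subset {suc n} (outside ∷ S) _ = inside ∷ S , out⊆ ⊆-refl , refl
grow-subset {suc n} (inside ∷ S) (s≤s ∣S∣<n) =
  let S′ , S⊆S′ , ∣S′∣≡ = grow-subset S ∣S∣<n
  in inside ∷ S′ , s⊆s S⊆S′ , cong suc ∣S′∣≡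

lookup-injective : ∀ {a} {A : Set a} {xs : List A} → Unique xs →
                   ∀ {i j} → lookup xs i ≡ lookup xs j → i ≡ j
lookup-injective {xs = x ∷ xs} _ {zero} {zero} _ = refl
lookup-injective {xs = x ∷ xs} (x∉ ∷ _) {zero} {suc j} x≡ = ⊥-elim (All.lookup x∉ (∈-lookup j) x≡)
lookup-injective {xs = x ∷ xs} (x∉ ∷ _) {suc i} {zero} ≡x = ⊥-elim (All.lookup x∉ (∈-lookup i) (sym ≡x))
lookup-injective {xs = x ∷ xs} (_ ∷ u) {suc i} {suc j} eq = cong suc (lookup-injective u eq)

2≤sum-map : ∀ {A : Set} (k : A → ℕ) → (∀ x → 1 ≤ k x) → (xs : List A) → xs ≢ [] →
            ¬ (∃ λ x → xs ≡ x ∷ [] × k x ≡ 1) → 2 ≤ sum (map k xs)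
2≤sum-map k 1≤k [] xs≢[] _ = ⊥-elim (xs≢[] refl)
2≤sum-map k 1≤k (x ∷ []) _ not-unit with k x in kx≡ | 1≤k x
... | suc zero    | _ = ⊥-elim (not-unit (x , refl , kx≡))
... | suc (suc _) | _ = s≤s (s≤s z≤n)
2≤sum-map k 1≤k (x ∷ y ∷ xs) _ _ = +-mono-≤ (1≤k x) (≤-trans (1≤k y) (m≤m+n _ _))

-- IsC p v k t is definitionally IsMinLength (IsGC p v k t).
IsMinLength : ∀ {B : Set} → (List B → Set) → ℕ → Set
IsMinLength {B} G n =
  (Σ (List B) (λ D → G D × length D ≡ n) × ((D : List B) → G D → n ≤ length D))
  ⊎ ((¬ Σ (List B) G) × n ≡ 0)

IsMinLength-map : ∀ {B₁ B₂ : Set} {G₁ : List B₁ → Set} {G₂ : List B₂ → Set}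
  (f : B₁ → B₂) (g : B₂ → B₁) → (∀ D → G₁ D → G₂ (map f D)) → (∀ D → G₂ D → G₁ (map g D)) →
  ∀ n → IsMinLength G₁ n → IsMinLength G₂ n
IsMinLength-map f g f-good g-good n (inj₁ ((D , good , len≡n) , minimal)) =
  inj₁ ( (map f D , f-good D good , trans (length-map f D) len≡n)
       , λ D′ good′ → subst (n ≤_) (length-map g D′) (minimal (map g D′) (g-good D′ good′)))
IsMinLength-map f g f-good g-good n (inj₂ (none , n≡0)) =
  inj₂ ((λ (D′ , good′) → none (map g D′ , g-good D′ good′)) , n≡0)

IsMinLength-⇔ : ∀ {B₁ B₂ : Set} {G₁ : List B₁ → Set} {G₂ : List B₂ → Set}
  (f : B₁ → B₂) (g : B₂ → B₁) → (∀ D → G₁ D → G₂ (map f D)) → (∀ D → G₂ D → G₁ (map g D)) →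
  ∀ n → IsMinLength G₁ n ⇔ IsMinLength G₂ n
IsMinLength-⇔ f g f-good g-good n =
  mk⇔ (IsMinLength-map f g f-good g-good n) (IsMinLength-map g f g-good f-good n)

module _ {p : ℕ} {v : Fin p → ℕ} where

  size : Tuple p v → ℕ
  size T = Σ-tuple (λ i → ∣ T i ∣)

  Fits : (Fin p → ℕ) → Tuple p v → Set
  Fits k T = ∀ i → ∣ T i ∣ ≤ k i

  _⊑_ : Tuple p v → Tuple p v → Set
  T ⊑ T′ = ∀ i → T i ⊆ T′ i

  ⊑-contained : ∀ {k} {T T′} {B : Block p v k} → T ⊑ T′ → ContainedIn p v k T′ B → ContainedIn p v k T B
  ⊑-contained T⊑T′ T′⊆B i = T′⊆B i ∘ T⊑T′ i

  update : Tuple p v → (i : Fin p) → Subset (v i) → Tuple p v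
  update T i S j = select (i Fin.≟ j)
    where
    select : Dec (i ≡ j) → Subset (v j)
    select (yes refl) = S
    select (no _)     = T j

  update-≡ : ∀ T i S → update T i S i ≡ S
  update-≡ T i S with i Fin.≟ i
  ... | yes refl = refl
  ... | no i≢i   = ⊥-elim (i≢i refl)

  update-≢ : ∀ T i S j → j ≢ i → update T i S j ≡ T j
  update-≢ T i S j j≢i with i Fin.≟ j
  ... | yes refl = ⊥-elim (j≢i refl)
  ... | no _     = refl

module Padding {p : ℕ} {v k : Fin p → ℕ} (k≤v : ∀ i → k i ≤ v i) where

  pad-at : ∀ T → Fits k T → ∀ i → ∣ T i ∣ < k i →
           ∃ λ T′ → T ⊑ T′ × Fits k T′ × size T′ ≡ suc (size T)
  pad-at T fits i ∣Ti∣<ki with grow-subset (T i) (<-≤-trans ∣Ti∣<ki (k≤v i))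
  ... | S , Ti⊆S , ∣S∣≡ =
    T′ , T⊑T′ , fits′ , Σ-tuple-sucAt (λ j → ∣ T j ∣) (λ j → ∣ T′ j ∣) i ∣T′i∣≡ T′-off
    where
    T′ = update T i S
    ∣T′i∣≡ : ∣ T′ i ∣ ≡ suc ∣ T i ∣
    ∣T′i∣≡ = trans (cong ∣_∣ (update-≡ T i S)) ∣S∣≡
    T′-off : ∀ j → j ≢ i → ∣ T′ j ∣ ≡ ∣ T j ∣
    T′-off j j≢i = cong ∣_∣ (update-≢ T i S j j≢i)
    T⊑T′ : T ⊑ T′
    T⊑T′ j with j Fin.≟ i
    ... | yes refl = subst (T i ⊆_) (sym (update-≡ T i S)) Ti⊆S
    ... | no j≢i   = subst (T j ⊆_) (sym (update-≢ T i S j j≢i)) ⊆-refl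
    fits′ : Fits k T′
    fits′ j with j Fin.≟ i
    ... | yes refl = subst (_≤ k i) (sym ∣T′i∣≡) ∣Ti∣<ki
    ... | no j≢i   = subst (_≤ k j) (sym (T′-off j j≢i)) (fits j)

  pad-one : ∀ T → Fits k T → size T < Σ-tuple k →
            ∃ λ T′ → T ⊑ T′ × Fits k T′ × size T′ ≡ suc (size T)
  pad-one T fits size<Σk =
    let i , ∣Ti∣<ki = Σ<Σ⇒∃< (λ j → ∣ T j ∣) k size<Σk in pad-at T fits i ∣Ti∣<ki

  pad : ∀ d T → Fits k T → size T + d ≤ Σ-tuple k →
        ∃ λ T′ → T ⊑ T′ × Fits k T′ × size T′ ≡ size T + d
  pad zero    T fits _ = T , (λ _ → ⊆-refl) , fits , sym (+-identityʳ _)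
  pad (suc d) T fits bound =
    let T₁ , T⊑T₁ , fits₁ , size₁≡ = pad-one T fits (≤-trans (m<m+n _ (s≤s z≤n)) bound)
        T₂ , T₁⊑T₂ , fits₂ , size₂≡ =
          pad d T₁ fits₁ (subst (λ s → s + d ≤ Σ-tuple k) (sym size₁≡) (subst (_≤ Σ-tuple k) (+-suc _ d) bound))
    in T₂ , (λ i → T₁⊑T₂ i ∘ T⊑T₁ i) , fits₂
       , trans size₂≡ (trans (cong (_+ d) size₁≡) (sym (+-suc _ d)))

  covers-smaller : ∀ {t D} → t ≤ Σ-tuple k → IsGC p v k t D →
                   ∀ T → Fits k T → size T ≤ t → Any (ContainedIn p v k T) D
  covers-smaller {t} t≤Σk gc T fits size≤t =
    let T′ , T⊑T′ , fits′ , size′≡ =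
          pad (t ∸ size T) T fits (subst (_≤ Σ-tuple k) (sym (m+[n∸m]≡n size≤t)) t≤Σk)
    in Any.map (λ {B} → ⊑-contained {k = k} {T} {T′} {B} T⊑T′)
         (gc T′ (fits′ , trans size′≡ (m+[n∸m]≡n size≤t)))

module Reduction (m : ℕ) (v k : Fin m → ℕ) where

  I : List (Fin m)
  I = diffPositions v k

  r : ℕ
  r = length I

  pos : Fin r → Fin m
  pos = lookup I

  vI kI : Fin r → ℕ
  vI = restrict v I
  kI = restrict k I

  differs? : Decidable (λ i → v i ≢ k i)
  differs? i = ¬? (v i ≟ k i)

  pos-differs : ∀ j → v (pos j) ≢ k (pos j)
  pos-differs j = proj₂ (∈-filter⁻ differs? {xs = allFin m} (∈-lookup j))

  pos-injective : ∀ {i j} → pos i ≡ pos j → i ≡ j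
  pos-injective = lookup-injective (filter⁺ differs? (allFin⁺ m))

  data Position (i : Fin m) : Set where
    unchanged : v i ≡ k i → Position i
    listed    : (j : Fin r) → pos j ≡ i → Position i

  position : ∀ i → Position i
  position i with v i ≟ k i
  ... | yes vi≡ki = unchanged vi≡ki
  ... | no  vi≢ki =
    let i∈I = ∈-filter⁺ differs? (∈-allFin i) vi≢ki
    in listed (Any.index i∈I) (sym (lookup-index i∈I))

  position-pos : ∀ j → position (pos j) ≡ listed j refl
  position-pos j with position (pos j)
  ... | unchanged vj≡kj = ⊥-elim (pos-differs j vj≡kj)
  ... | listed j′ e with pos-injective e
  position-pos j | listed .j refl | refl = refl

  restrictBlock : Block m v k → Block r vI kI
  restrictBlock B = B ∘ pos

  fillBlock : Block r vI kI → ∀ {i} → Position i → Σ (Subset (v i)) (λ B → ∣ B ∣ ≡ k i)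
  fillBlock B′ {i} (unchanged vi≡ki) = ⊤ , trans (∣⊤∣≡n (v i)) vi≡ki
  fillBlock B′     (listed j refl)   = B′ j

  extendBlock : Block r vI kI → Block m v k
  extendBlock B′ i = fillBlock B′ (position i)

  fillTuple : Tuple r vI → ∀ {i} → Position i → Subset (v i)
  fillTuple T′ (unchanged _)   = ⊥
  fillTuple T′ (listed j refl) = T′ j

  extendTuple : Tuple r vI → Tuple m v
  extendTuple T′ i = fillTuple T′ (position i)

  extendTuple-pos : ∀ T′ j → extendTuple T′ (pos j) ≡ T′ j
  extendTuple-pos T′ j = cong (fillTuple T′) (position-pos j)

  extendTuple-fits : ∀ T′ → Fits kI T′ → Fits k (extendTuple T′)
  extendTuple-fits T′ fits i with position i
  ... | unchanged _   = subst (_≤ k i) (sym (∣⊥∣≡0 (v i))) z≤n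
  ... | listed j refl = fits j

  extendTuple-unlisted : ∀ T′ i → ¬ (v i ≢ k i) → ∣ extendTuple T′ i ∣ ≡ 0
  extendTuple-unlisted T′ i ¬vi≢ki with position i
  ... | unchanged _   = ∣⊥∣≡0 (v i)
  ... | listed j refl = ⊥-elim (¬vi≢ki (pos-differs j))

  size-extendTuple : ∀ T′ → size (extendTuple T′) ≡ size T′
  size-extendTuple T′ = begin
    Σ-tuple f                    ≡⟨ Σ-tuple≡sum-allFin f ⟩
    sum (map f (allFin m))       ≡⟨ sum-map-filter differs? f (extendTuple-unlisted T′) (allFin m) ⟨
    sum (map f I)                ≡⟨ Σ-tuple-lookup I f ⟨
    Σ-tuple (f ∘ pos)            ≡⟨ sum-cong-≗ (cong ∣_∣ ∘ extendTuple-pos T′) ⟩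
    size T′                      ∎
    where
    open ≡-Reasoning
    f = λ i → ∣ extendTuple T′ i ∣

  size-restrict-≤ : ∀ (T : Tuple m v) → size {v = vI} (T ∘ pos) ≤ size T
  size-restrict-≤ T = begin
    Σ-tuple (f ∘ pos)        ≡⟨ Σ-tuple-lookup I f ⟩
    sum (map f I)            ≤⟨ sum-map-filter-≤ differs? f (allFin m) ⟩
    sum (map f (allFin m))   ≡⟨ Σ-tuple≡sum-allFin f ⟨
    Σ-tuple f                ∎
    where
    open ≤-Reasoning
    f = λ i → ∣ T i ∣

  restrict-GC : ∀ {t D} → IsGC m v k t D → IsGC r vI kI t (map restrictBlock D)
  restrict-GC gc T′ (fits , size≡t) =
    map⁺ (Any.map (λ {B} → restricted {B})
      (gc (extendTuple T′) (extendTuple-fits T′ fits , trans (size-extendTuple T′) size≡t)))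
    where
    restricted : ∀ {B} → ContainedIn m v k (extendTuple T′) B → ContainedIn r vI kI T′ (restrictBlock B)
    restricted ⊆B j = ⊆B (pos j) ∘ subst (_ ∈_) (sym (extendTuple-pos T′ j))

  extend-GC : (∀ i → k i ≤ v i) → ∀ {t D′} → t ≤ Σ-tuple kI →
              IsGC r vI kI t D′ → IsGC m v k t (map extendBlock D′)
  extend-GC k≤v t≤ΣkI gc T (fits , size≡t) =
    map⁺ (Any.map extended
      (Padding.covers-smaller (k≤v ∘ pos) t≤ΣkI gc (T ∘ pos) (fits ∘ pos)
        (subst (size (T ∘ pos) ≤_) size≡t (size-restrict-≤ T))))
    where
    extended : ∀ {B′} → ContainedIn r vI kI (T ∘ pos) B′ → ContainedIn m v k T (extendBlock B′)
    extended ⊆B′ i with position i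
    ... | unchanged _   = ⊆⊤
    ... | listed j refl = ⊆B′ j

  IsC-restrict-⇔ : (∀ i → k i ≤ v i) → ∀ {t} → t ≤ Σ-tuple kI →
                   ∀ n → IsC m v k t n ⇔ IsC r vI kI t n
  IsC-restrict-⇔ k≤v t≤ΣkI =
    IsMinLength-⇔ restrictBlock extendBlock (λ _ → restrict-GC) (λ _ → extend-GC k≤v t≤ΣkI)

proposition3p11 : (m : ℕ) (v k : Fin m → ℕ)
    → ((i : Fin m) → 1 ≤ v i) → ((i : Fin m) → 1 ≤ k i)
    → ((i : Fin m) → k i ≤ v i)
    → 2 ≤ Σ-tuple k
    → diffPositions v k ≢ []
    → ¬ (∃ λ i → diffPositions v k ≡ i ∷ [] × k i ≡ 1)
    → (n : ℕ) → IsC m v k 2 n ⇔ IsC (length (diffPositions v k)) (restrict v (diffPositions v k)) (restrict k (diffPositions v k)) 2 n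
-- The hypotheses 1 ≤ v_i and 2 ≤ Σ k are implied by the others.
proposition3p11 m v k _ 1≤k k≤v _ I≢[] kI≢[1] =
  IsC-restrict-⇔ k≤v 2≤ΣkI
  where
  open Reduction m v k
  2≤ΣkI : 2 ≤ Σ-tuple kI
  2≤ΣkI = subst (2 ≤_) (sym (Σ-tuple-lookup I k)) (2≤sum-map k 1≤k I I≢[] kI≢[1])
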